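{- Let $F_1,\dots,F_n$ be pairwise edge-disjoint matchings, each of size $n$, in a graph. Let $R$ be a rainbow matching of maximum possible size $q$, with a fixed injection $\phi:R\to[n]$ satisfying $e\in F_{\phi(e)}$ for all $e\in R$, and let $J=[n]\setminus\phi(R)$. For $j\in J$, call a pair $\{e,f\}$ of distinct edges of $R$ half-$j$-wasteful if $F_j$ contains edges $g_e,g_f,g_{ef}$ such that $g_e$ intersects $e$ and no other edge of $R$, $g_f$ intersects $f$ and no other edge of $R$, and $g_{ef}$ intersects both $e$ and $f$. For $e\in R$ let $HW(e)$ be the set of $j\in J$ for which there is $f\in R$ with $\{e,f\}$ half-$j$-wasteful. Then $\sum_{e\in R}|HW(e)|\le 4q$.
   Context: A rainbow matching is a matching $M$ together with an injection $\psi:M\to[n]$ with $x\in F_{\psi(x)}$ for every $x\in M$; "maximum possible size" is over all rainbow matchings. -}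

module Defs where

open import Data.Nat using (ℕ; _<_)
open import Data.Fin using (Fin)
open import Data.List using (List; map; length; lookup)
open import Data.List.Membership.Propositional using (_∈_; _∉_)
open import Data.List.Relation.Unary.All using (All)
open import Data.List.Relation.Unary.AllPairs using (AllPairs)
open import Data.List.Relation.Unary.Unique.Propositional using (Unique)
open import Data.Product using (Σ; ∃; _×_; _,_; proj₁; proj₂)
open import Data.Sum using (_⊎_)
open import Relation.Binary.PropositionalEquality using (_≡_; _≢_)
open import Relation.Nullary using (¬_)

-- Vertices are natural numbers; an edge is an ordered pair (u , v),
-- required (where it matters) to satisfy u < v, i.e. a canonical
-- representation of the 2-element vertex set {u , v}.
Edge : Set
Edge = ℕ × ℕ

ValidEdge : Edge → Set
ValidEdge (u , v) = u < v

_∈ᵥ_ : ℕ → Edge → Set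
x ∈ᵥ (u , v) = (x ≡ u) ⊎ (x ≡ v)

Intersects : Edge → Edge → Set
Intersects e f = ∃ λ x → x ∈ᵥ e × x ∈ᵥ f

IsMatching : List Edge → Set
IsMatching M = All ValidEdge M × AllPairs (λ e f → ¬ Intersects e f) M

module _ {n : ℕ} (F : Fin n → List Edge) where

  -- rainbow matching: list of pairs (edge , colour ψ(edge)); the edges form
  -- a matching, ψ is injective, and each edge lies in the matching of its colour
  IsRainbow : List (Edge × Fin n) → Set
  IsRainbow M = IsMatching (map proj₁ M) × Unique (map proj₂ M)
              × All (λ p → proj₁ p ∈ F (proj₂ p)) M

  IsMaximumRainbow : List (Edge × Fin n) → Set
  IsMaximumRainbow R = IsRainbow R ×
    ((M : List (Edge × Fin n)) → IsRainbow M → length M Data.Nat.≤ length R)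

  module _ (R : List (Edge × Fin n)) where

    edgesR : List Edge
    edgesR = map proj₁ R

    InJ : Fin n → Set
    InJ j = j ∉ map proj₂ R

    OnlyMeets : Edge → Edge → Set
    OnlyMeets g e = Intersects g e × ((f : Edge) → f ∈ edgesR → f ≢ e → ¬ Intersects g f)

    HalfWasteful : Fin n → Edge → Edge → Set
    HalfWasteful j e f = e ≢ f × ∃ λ ge → ∃ λ gf → ∃ λ gef →
      ge ∈ F j × gf ∈ F j × gef ∈ F j ×
      OnlyMeets ge e × OnlyMeets gf f × Intersects gef e × Intersects gef f

    InHW : Edge → Fin n → Set
    InHW e j = InJ j × ∃ λ f → f ∈ edgesR × HalfWasteful j e f

{-# OPTIONS --safe #-}
module Submission where

-- A pendant at an edge e of R is an edge of some F k, k ∈ J, joining an end of e to a vertex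
-- outside V(R). As R is maximum, it cannot be enlarged by exchanging e for two disjoint pendants at
-- its two ends, nor e and f for a disjoint pendant–bridge–pendant path through them, when the new
-- edges have distinct colours in J. Hence if |HW(e)| ≥ 5, all pendants at e sit at one end and every
-- partner f of e carries pendants of at most two colours. Charge each pair (e , j) with j ∈ HW(e) to
-- e when |HW(e)| ≤ 4, and otherwise to the partner of e for j, which is unique. The charges an edge
-- receives from heavy edges, and those from itself, come in distinct colours with pendants at it, so
-- it receives at most 2 + 2 of them, or at most 4 when no heavy edge charges it.

open import Defs
open import Data.Bool using (Bool; false; true)
open import Data.Empty using (⊥; ⊥-elim)
open import Data.Fin using (Fin)
import Data.Fin as Fin
open import Data.List using (List; []; _∷_; _++_; length; lookup; map; filter; allFin)
open import Data.List.Properties using (filter-all; length-tabulate; length-++; length-map)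
open import Data.List.Membership.Propositional using (_∈_; _∉_; find)
open import Data.List.Membership.Propositional.Properties
  using (∈-filter⁻; ∈-allFin; ∈-lookup; ∈-map⁺; ∈-map⁻)
open import Data.List.Relation.Binary.Sublist.Propositional using (_⊆_)
import Data.List.Relation.Binary.Sublist.Propositional.Properties as Sublist
open import Data.List.Relation.Unary.All as All using (All; []; _∷_)
open import Data.List.Relation.Unary.All.Properties
  using (all-filter; All¬⇒¬Any; ¬All⇒Any¬; ¬Any⇒All¬)
  renaming (filter⁺ to All-filter⁺; ++⁺ to All-++⁺; map⁺ to All-map⁺; map⁻ to All-map⁻;
            ++⁻ˡ to All-++⁻ˡ; ++⁻ʳ to All-++⁻ʳ)
open import Data.List.Relation.Unary.AllPairs as AllPairs using (AllPairs; []; _∷_)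
import Data.List.Relation.Unary.AllPairs.Properties as AllPairs
open import Data.List.Relation.Unary.Any using (Any; here; there; any?; satisfied)
import Data.List.Relation.Unary.Any as Any
open import Data.List.Relation.Unary.Any.Properties using (lookup-index)
open import Data.List.Relation.Unary.Unique.Propositional using (Unique)
open import Data.Nat using (ℕ; suc; _+_; _*_; _≤_; _<_; z≤n; s≤s; s≤s⁻¹)
open import Data.Nat.Properties
open import Data.Product using (Σ; ∃-syntax; _×_; _,_; proj₁; proj₂)
open import Data.Product.Properties using (≡-dec; ×-≡,≡→≡)
open import Data.Sum using (_⊎_; inj₁; inj₂)
import Data.Sum
open import Level using (0ℓ)
open import Relation.Binary.Definitions using (DecidableEquality)
open import Relation.Binary.PropositionalEquality
  using (_≡_; _≢_; refl; sym; trans; cong; cong₂; subst; subst₂; ≢-sym)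
open import Relation.Nullary using (¬_; Dec; yes; no; contradiction; _×-dec_)
open import Relation.Unary using (Pred; Decidable)
open import Relation.Unary.Properties using (∁?)

module _ {A : Set} {P : Pred A 0ℓ} (P? : Decidable P) where

  length-filter+filter-∁ : ∀ xs → length (filter P? xs) + length (filter (∁? P?) xs) ≡ length xs
  length-filter+filter-∁ [] = refl
  length-filter+filter-∁ (x ∷ xs) with P? x
  ... | yes _ = cong suc (length-filter+filter-∁ xs)
  ... | no  _ = trans (+-suc _ _) (cong suc (length-filter+filter-∁ xs))

  length≤suc-filter-∁ : ∀ {xs} → AllPairs (λ a b → ¬ (P a × P b)) xs →
                        length xs ≤ suc (length (filter (∁? P?) xs))
  length≤suc-filter-∁ [] = z≤n
  length≤suc-filter-∁ {x ∷ xs} (x-alone ∷ rest) with P? x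
  ... | yes px = s≤s (≤-reflexive (sym (cong length
                   (filter-all (∁? P?) (All.map (λ ¬both py → ¬both (px , py)) x-alone)))))
  ... | no  _  = s≤s (length≤suc-filter-∁ rest)

module _ {A : Set} {P : Pred A 0ℓ} {R : A → A → Set} where

  All-AllPairs⇒AllPairs : ∀ {xs} → All P xs → AllPairs (λ a b → P a → P b → R a b) xs → AllPairs R xs
  All-AllPairs⇒AllPairs [] [] = []
  All-AllPairs⇒AllPairs (px ∷ pxs) (rx ∷ rxs) =
    All.zipWith (λ (py , r) → r px py) (pxs , rx) ∷ All-AllPairs⇒AllPairs pxs rxs

module _ {X K : Set} (Hits : X → K → Set) (Hits? : ∀ x k → Dec (Hits x k)) where

  avoid : ∀ ks {xs} → AllPairs (λ a b → ∀ k → ¬ (Hits a k × Hits b k)) xs → length ks < length xs →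
          ∃[ x ] x ∈ xs × All (λ k → ¬ Hits x k) ks
  avoid [] {x ∷ _} _ _ = x , here refl , []
  avoid (k ∷ ks) {xs} unshared ks<xs with avoid ks (AllPairs.filter⁺ misses-k? unshared) ks<spared
    where
    misses-k? = ∁? (λ x → Hits? x k)
    ks<spared : length ks < length (filter misses-k? xs)
    ks<spared = s≤s⁻¹ (≤-trans ks<xs
      (length≤suc-filter-∁ (λ x → Hits? x k) (AllPairs.map (λ unshared-ab → unshared-ab k) unshared)))
  ... | x , x∈ , misses with ∈-filter⁻ (∁? (λ x → Hits? x k)) x∈
  ...   | x∈xs , misses-k = x , x∈xs , misses-k ∷ misses

  all-hit⇒length≤ : ∀ ks {xs} → AllPairs (λ a b → ∀ k → ¬ (Hits a k × Hits b k)) xs →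
                    All (λ x → Any (Hits x) ks) xs → length xs ≤ length ks
  all-hit⇒length≤ ks unshared hit = ≮⇒≥ λ ks<xs →
    let (x , x∈ , misses) = avoid ks unshared ks<xs in All¬⇒¬Any misses (All.lookup hit x∈)

module _ {A : Set} {m : ℕ} (t : A → Fin m) where

  fibre : Fin m → List A → List A
  fibre z = filter (λ x → t x Fin.≟ z)

  private
    length≤*-fibres-within : ∀ k zs xs → All (λ x → t x ∈ zs) xs → (∀ z → length (fibre z xs) ≤ k) →
                             length xs ≤ length zs * k
    length≤*-fibres-within k [] [] _ _ = z≤n
    length≤*-fibres-within k [] (_ ∷ _) (() ∷ _) _
    length≤*-fibres-within k (z ∷ zs) xs within bounded = begin
      length xs                            ≡⟨ sym (length-filter+filter-∁ (λ x → t x Fin.≟ z) xs) ⟩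
      length (fibre z xs) + length others  ≤⟨ +-mono-≤ (bounded z)
                                                (length≤*-fibres-within k zs others within′ bounded′) ⟩
      k + length zs * k                    ∎
      where
      open ≤-Reasoning
      off? = ∁? (λ x → t x Fin.≟ z)
      others = filter off? xs
      within′ : All (λ x → t x ∈ zs) others
      within′ = All.zipWith (λ { (here t≡z , t≢z) → contradiction t≡z t≢z ; (there t∈ , _) → t∈ })
                            (All-filter⁺ off? within , all-filter off? xs)
      bounded′ : ∀ z′ → length (fibre z′ others) ≤ k
      bounded′ z′ = ≤-trans
        (Sublist.length-mono-≤ (Sublist.filter⁺ _ _ (λ { refl p → p }) (Sublist.filter-⊆ off? xs)))
        (bounded z′)

  length≤*-fibres : ∀ k xs → (∀ z → length (fibre z xs) ≤ k) → length xs ≤ m * k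
  length≤*-fibres k xs bounded = subst (λ l → length xs ≤ l * k) (length-tabulate {n = m} (λ i → i))
    (length≤*-fibres-within k (allFin m) xs (All.tabulate (λ {x} _ → ∈-allFin (t x))) bounded)

lookup-injective : ∀ {A B : Set} (f : A → B) {xs} → AllPairs (λ a b → f a ≢ f b) xs →
                   ∀ i j → f (lookup xs i) ≡ f (lookup xs j) → i ≡ j
lookup-injective f (_ ∷ _)     Fin.zero    Fin.zero    _  = refl
lookup-injective f (apart ∷ _) Fin.zero    (Fin.suc j) eq = contradiction eq (All.lookup apart (∈-lookup j))
lookup-injective f (apart ∷ _) (Fin.suc i) Fin.zero    eq =
  contradiction (sym eq) (All.lookup apart (∈-lookup i))
lookup-injective f (_ ∷ rest)  (Fin.suc i) (Fin.suc j) eq = cong Fin.suc (lookup-injective f rest i j eq)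

map-proj₁-toList : ∀ {A : Set} {P : Pred A 0ℓ} {xs} (pxs : All P xs) → map proj₁ (All.toList pxs) ≡ xs
map-proj₁-toList [] = refl
map-proj₁-toList (_ ∷ pxs) = cong (_ ∷_) (map-proj₁-toList pxs)

_≟ₑ_ : DecidableEquality Edge
_≟ₑ_ = ≡-dec _≟_ _≟_

Intersects-sym : ∀ {e f} → Intersects e f → Intersects f e
Intersects-sym (v , v∈e , v∈f) = v , v∈f , v∈e

disjoint⇒≢ : ∀ {e f} → ¬ Intersects e f → e ≢ f
disjoint⇒≢ {u , _} apart refl = apart (u , inj₁ refl , inj₁ refl)

matching-meet⇒≡ : ∀ {M e f} → AllPairs (λ e f → ¬ Intersects e f) M → e ∈ M → f ∈ M →
                  Intersects e f → e ≡ f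
matching-meet⇒≡ (_ ∷ _)     (here refl) (here refl) _    = refl
matching-meet⇒≡ (apart ∷ _) (here refl) (there f∈)  meet = contradiction meet (All.lookup apart f∈)
matching-meet⇒≡ (apart ∷ _) (there e∈)  (here refl) meet =
  contradiction (Intersects-sym meet) (All.lookup apart e∈)
matching-meet⇒≡ (_ ∷ rest)  (there e∈)  (there f∈)  meet = matching-meet⇒≡ rest e∈ f∈ meet

Ends : Edge → ℕ → ℕ → Set
Ends g a b = a ∈ᵥ g × b ∈ᵥ g × (∀ v → v ∈ᵥ g → v ≡ a ⊎ v ≡ b)

Ends-swap : ∀ {g a b} → Ends g a b → Ends g b a
Ends-swap (a∈ , b∈ , only) = b∈ , a∈ , λ v v∈ → Data.Sum.swap (only v v∈)

distinct-Ends : ∀ {g a b} → a ∈ᵥ g → b ∈ᵥ g → a ≢ b → Ends g a b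
distinct-Ends (inj₁ refl) (inj₁ refl) a≢b = contradiction refl a≢b
distinct-Ends (inj₂ refl) (inj₂ refl) a≢b = contradiction refl a≢b
distinct-Ends (inj₁ refl) (inj₂ refl) _   = inj₁ refl , inj₂ refl , λ _ v∈ → v∈
distinct-Ends (inj₂ refl) (inj₁ refl) _   = inj₂ refl , inj₁ refl , λ _ v∈ → Data.Sum.swap v∈

other-end : ∀ {g a} → ValidEdge g → a ∈ᵥ g → ∃[ b ] a ≢ b × Ends g a b
other-end {p , q} p<q (inj₁ refl) = q , p≢q , distinct-Ends (inj₁ refl) (inj₂ refl) p≢q
  where p≢q = <⇒≢ p<q
other-end {p , q} p<q (inj₂ refl) = p , q≢p , distinct-Ends (inj₂ refl) (inj₁ refl) q≢p
  where q≢p = ≢-sym (<⇒≢ p<q)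

Ends-unique : ∀ {g g′ a b} → ValidEdge g → ValidEdge g′ → Ends g a b → Ends g′ a b → g ≡ g′
Ends-unique {p , q} {g′} p<q g′-valid (_ , _ , only) (a∈ , b∈ , _) =
  sorted-≡ (on-g′ (only p (inj₁ refl))) (on-g′ (only q (inj₂ refl)))
  where
  on-g′ : ∀ {v} → v ≡ _ ⊎ v ≡ _ → v ∈ᵥ g′
  on-g′ (inj₁ refl) = a∈
  on-g′ (inj₂ refl) = b∈
  sorted-≡ : p ∈ᵥ g′ → q ∈ᵥ g′ → (p , q) ≡ g′
  sorted-≡ (inj₁ refl) (inj₁ refl) = contradiction refl (<⇒≢ p<q)
  sorted-≡ (inj₁ refl) (inj₂ refl) = refl
  sorted-≡ (inj₂ refl) (inj₁ refl) = contradiction p<q (<⇒≯ g′-valid)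
  sorted-≡ (inj₂ refl) (inj₂ refl) = contradiction refl (<⇒≢ p<q)

Ends-avoids : ∀ {g h a b} → Ends g a b → ¬ a ∈ᵥ h → ¬ b ∈ᵥ h → ¬ Intersects g h
Ends-avoids (_ , _ , only) a∉ b∉ (v , v∈g , v∈h) with only v v∈g
... | inj₁ refl = a∉ v∈h
... | inj₂ refl = b∉ v∈h

∉-Ends : ∀ {g a b v} → Ends g a b → v ≢ a → v ≢ b → ¬ v ∈ᵥ g
∉-Ends (_ , _ , only) v≢a v≢b v∈ with only _ v∈
... | inj₁ v≡a = v≢a v≡a
... | inj₂ v≡b = v≢b v≡b

module MaximumRainbow (n : ℕ) (F : Fin n → List Edge)
  (F-matching : (i : Fin n) → IsMatching (F i))
  (F-disjoint : (i j : Fin n) → i ≢ j → (e : Edge) → e ∈ F i → e ∉ F j)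
  (R : List (Edge × Fin n)) (R-maximum : IsMaximumRainbow F R) where

  Rₑ : List Edge
  Rₑ = edgesR F R

  J : Fin n → Set
  J = InJ F R

  R-rainbow : IsRainbow F R
  R-rainbow = proj₁ R-maximum

  R-valid : ∀ {e} → e ∈ Rₑ → ValidEdge e
  R-valid = All.lookup (proj₁ (proj₁ R-rainbow))

  F-valid : ∀ {k g} → g ∈ F k → ValidEdge g
  F-valid {k} = All.lookup (proj₁ (F-matching k))

  R-apart : AllPairs (λ a b → ¬ Intersects (proj₁ a) (proj₁ b)) R
  R-apart = AllPairs.map⁻ (proj₂ (proj₁ R-rainbow))

  R-colours : AllPairs (λ a b → proj₂ a ≢ proj₂ b) R
  R-colours = AllPairs.map⁻ (proj₁ (proj₂ R-rainbow))

  R-in-F : All (λ p → proj₁ p ∈ F (proj₂ p)) R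
  R-in-F = proj₂ (proj₂ R-rainbow)

  R-meet⇒≡ : ∀ {e h} → e ∈ Rₑ → h ∈ Rₑ → Intersects e h → e ≡ h
  R-meet⇒≡ = matching-meet⇒≡ (proj₂ (proj₁ R-rainbow))

  F-meet⇒≡ : ∀ {k g g′} → g ∈ F k → g′ ∈ F k → Intersects g g′ → g ≡ g′
  F-meet⇒≡ {k} = matching-meet⇒≡ (proj₂ (F-matching k))

  F-colour-unique : ∀ {k k′ g} → g ∈ F k → g ∈ F k′ → k ≡ k′
  F-colour-unique {k} {k′} g∈ g∈′ with k Fin.≟ k′
  ... | yes k≡k′ = k≡k′
  ... | no  k≢k′ = contradiction g∈′ (F-disjoint k k′ k≢k′ _ g∈)

  J-colour∉R : ∀ {k e} → J k → e ∈ Rₑ → e ∉ F k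
  J-colour∉R k∈J e∈R e∈F with ∈-map⁻ proj₁ e∈R
  ... | _ , p∈R , refl =
    k∈J (subst (_∈ map proj₂ R) (F-colour-unique (All.lookup R-in-F p∈R) e∈F) (∈-map⁺ proj₂ p∈R))

  Uncovered : ℕ → Set
  Uncovered x = ∀ {h} → h ∈ Rₑ → ¬ x ∈ᵥ h

  ∉ᵥ-other : ∀ {e h v} → e ∈ Rₑ → h ∈ Rₑ → e ≢ h → v ∈ᵥ e → ¬ v ∈ᵥ h
  ∉ᵥ-other e∈ h∈ e≢h v∈e v∈h = e≢h (R-meet⇒≡ e∈ h∈ (_ , v∈e , v∈h))

  separate : ∀ {e f v w} → e ∈ Rₑ → f ∈ Rₑ → e ≢ f → v ∈ᵥ e → w ∈ᵥ f → v ≢ w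
  separate e∈ f∈ e≢f v∈e w∈f refl = ∉ᵥ-other e∈ f∈ e≢f v∈e w∈f

  covered≢uncovered : ∀ {e v x} → e ∈ Rₑ → v ∈ᵥ e → Uncovered x → v ≢ x
  covered≢uncovered e∈ v∈ x-uncovered refl = x-uncovered e∈ v∈

  record Pendant (k : Fin n) (e : Edge) (s x : ℕ) : Set where
    field
      edge : Edge
      ∈F : edge ∈ F k
      ends : Ends edge s x
      end∈ : s ∈ᵥ e
      uncovered : Uncovered x

  record Bridge (k : Fin n) (e f : Edge) (t d : ℕ) : Set where
    field
      edge : Edge
      ∈F : edge ∈ F k
      ends : Ends edge t d
      t∈ : t ∈ᵥ e
      d∈ : d ∈ᵥ f

  open Pendant
  open Bridge

  only-meets⇒pendant : ∀ {k e g} → J k → e ∈ Rₑ → g ∈ F k → OnlyMeets F R g e →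
                       ∃[ s ] ∃[ x ] Pendant k e s x
  only-meets⇒pendant {k} {e} {g} k∈J e∈R g∈F ((s , s∈g , s∈e) , meets-only-e)
    with other-end (F-valid g∈F) s∈g
  ... | x , s≢x , g-ends =
    s , x , record { edge = g ; ∈F = g∈F ; ends = g-ends ; end∈ = s∈e ; uncovered = x-uncovered }
    where
    x-uncovered : Uncovered x
    x-uncovered {h} h∈R x∈h with h ≟ₑ e
    ... | no  h≢e  = meets-only-e h h∈R h≢e (x , proj₁ (proj₂ g-ends) , x∈h)
    ... | yes refl = J-colour∉R k∈J e∈R (subst (_∈ F k)
          (Ends-unique (F-valid g∈F) (R-valid e∈R) g-ends (distinct-Ends s∈e x∈h s≢x)) g∈F)

  meets-both⇒bridge : ∀ {k e f g} → e ∈ Rₑ → f ∈ Rₑ → e ≢ f → g ∈ F k →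
                      Intersects g e → Intersects g f → ∃[ t ] ∃[ d ] Bridge k e f t d
  meets-both⇒bridge e∈ f∈ e≢f g∈F (t , t∈g , t∈e) (d , d∈g , d∈f) = t , d , record
    { edge = _ ; ∈F = g∈F ; ends = distinct-Ends t∈g d∈g (separate e∈ f∈ e≢f t∈e d∈f)
    ; t∈ = t∈e ; d∈ = d∈f }

  pendant-avoids : ∀ {k e s x h} → e ∈ Rₑ → (p : Pendant k e s x) → h ∈ Rₑ → h ≢ e →
                   ¬ Intersects (edge p) h
  pendant-avoids e∈ p h∈ h≢e =
    Ends-avoids (ends p) (∉ᵥ-other e∈ h∈ (≢-sym h≢e) (end∈ p)) (uncovered p h∈)

  bridge-avoids : ∀ {k e f t d h} → e ∈ Rₑ → f ∈ Rₑ → (β : Bridge k e f t d) →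
                  h ∈ Rₑ → h ≢ e → h ≢ f → ¬ Intersects (edge β) h
  bridge-avoids e∈ f∈ β h∈ h≢e h≢f =
    Ends-avoids (ends β) (∉ᵥ-other e∈ h∈ (≢-sym h≢e) (t∈ β)) (∉ᵥ-other f∈ h∈ (≢-sym h≢f) (d∈ β))

  -- A shared vertex would make the two edges one edge of F k, whose ends t and d would then both
  -- be the covered end s of the pendant.
  pendant-bridge-apart : ∀ {k a s x b c t d} → b ∈ Rₑ → c ∈ Rₑ → b ≢ c →
                         (p : Pendant k a s x) (β : Bridge k b c t d) → ¬ Intersects (edge p) (edge β)
  pendant-bridge-apart {s = s} b∈ c∈ b≢c p β meet =
    separate b∈ c∈ b≢c (t∈ β) (d∈ β)
      (trans (is-s (proj₁ (ends β)) b∈ (t∈ β)) (sym (is-s (proj₁ (proj₂ (ends β))) c∈ (d∈ β))))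
    where
    is-s : ∀ {v h} → v ∈ᵥ edge β → h ∈ Rₑ → v ∈ᵥ h → v ≡ s
    is-s {v} v∈β h∈ v∈h
      with proj₂ (proj₂ (ends p)) v (subst (v ∈ᵥ_) (sym (F-meet⇒≡ (∈F p) (∈F β) meet)) v∈β)
    ... | inj₁ v≡s  = v≡s
    ... | inj₂ refl = contradiction v∈h (uncovered p h∈)

  same-ends⇒same-colour : ∀ {k k′ e e′ s s′ x x′} → Pendant k e s x → Pendant k′ e′ s′ x′ →
                          s ≡ s′ → x ≡ x′ → k ≡ k′
  same-ends⇒same-colour {k′ = k′} p p′ refl refl = F-colour-unique (∈F p)
    (subst (_∈ F k′) (sym (Ends-unique (F-valid (∈F p)) (F-valid (∈F p′)) (ends p) (ends p′)))
           (∈F p′))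

  on? : (Es : List Edge) (p : Edge × Fin n) → Dec (proj₁ p ∈ Es)
  on? Es p = any? (proj₁ p ≟ₑ_) Es

  R-without : List Edge → List (Edge × Fin n)
  R-without Es = filter (∁? (on? Es)) R

  length-R≤ : ∀ Es → length R ≤ length Es + length (R-without Es)
  length-R≤ Es = begin
    length R                                          ≡⟨ sym (length-filter+filter-∁ (on? Es) R) ⟩
    length (filter (on? Es) R) + length (R-without Es) ≤⟨ +-monoˡ-≤ _ removed≤Es ⟩
    length Es + length (R-without Es)                 ∎
    where
    open ≤-Reasoning
    removed≤Es : length (filter (on? Es) R) ≤ length Es
    removed≤Es = all-hit⇒length≤ (λ p e → proj₁ p ≡ e) (λ p e → proj₁ p ≟ₑ e) Es
      (AllPairs.filter⁺ (on? Es)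
        (AllPairs.map (λ apart _ (a≡e , b≡e) → disjoint⇒≢ apart (trans a≡e (sym b≡e))) R-apart))
      (all-filter (on? Es) R)

  exchange-rainbow : ∀ Es L → IsRainbow F L → All (λ p → J (proj₂ p)) L →
                     All (λ p → ∀ {h} → h ∈ Rₑ → h ∉ Es → ¬ Intersects (proj₁ p) h) L →
                     IsRainbow F (L ++ R-without Es)
  exchange-rainbow Es L ((L-valid , L-apart) , L-colours , L-in-F) L-unused L-avoids =
    ( All-map⁺ (All-++⁺ (All-map⁻ L-valid)
                         (All.tabulate λ p∈ → R-valid (∈-map⁺ proj₁ (kept⊆R p∈))))
    , AllPairs.map⁺ (AllPairs.++⁺ (AllPairs.map⁻ L-apart) (AllPairs.filter⁺ _ R-apart)
        (All.map (λ avoids → All.tabulate λ p∈ → avoids (∈-map⁺ proj₁ (kept⊆R p∈)) (kept∉Es p∈))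
                 L-avoids)) )
    , AllPairs.map⁺ (AllPairs.++⁺ (AllPairs.map⁻ L-colours) (AllPairs.filter⁺ _ R-colours)
        (All.map (λ unused → All.tabulate λ p∈ k≡ →
                    unused (subst (_∈ map proj₂ R) (sym k≡) (∈-map⁺ proj₂ (kept⊆R p∈))))
                 L-unused))
    , All-++⁺ L-in-F (All.tabulate λ p∈ → All.lookup R-in-F (kept⊆R p∈))
    where
    kept⊆R : ∀ {p} → p ∈ R-without Es → p ∈ R
    kept⊆R p∈ = proj₁ (∈-filter⁻ (∁? (on? Es)) {xs = R} p∈)
    kept∉Es : ∀ {p} → p ∈ R-without Es → proj₁ p ∉ Es
    kept∉Es p∈ = proj₂ (∈-filter⁻ (∁? (on? Es)) {xs = R} p∈)

  augment : ∀ Es L → IsRainbow F L → All (λ p → J (proj₂ p)) L →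
            All (λ p → ∀ {h} → h ∈ Rₑ → h ∉ Es → ¬ Intersects (proj₁ p) h) L →
            length Es < length L → ⊥
  augment Es L L-rainbow L-unused L-avoids Es<L =
    <⇒≱ R<exchanged (proj₂ R-maximum _ (exchange-rainbow Es L L-rainbow L-unused L-avoids))
    where
    open ≤-Reasoning
    R<exchanged : length R < length (L ++ R-without Es)
    R<exchanged = begin-strict
      length R                          ≤⟨ length-R≤ Es ⟩
      length Es + length (R-without Es) <⟨ +-monoˡ-< _ Es<L ⟩
      length L + length (R-without Es)  ≡⟨ sym (length-++ L) ⟩
      length (L ++ R-without Es)        ∎

  ¬two-pendants : ∀ {k k′ e s s′ x x′} → e ∈ Rₑ → J k → J k′ →
                  Pendant k e s x → Pendant k′ e s′ x′ → s ≢ s′ → k ≢ k′ → x ≢ x′ → ⊥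
  ¬two-pendants {k} {k′} {e} e∈ k∈J k′∈J p p′ s≢s′ k≢k′ x≢x′ =
    augment (e ∷ []) ((edge p , k) ∷ (edge p′ , k′) ∷ [])
      ( (F-valid (∈F p) ∷ F-valid (∈F p′) ∷ [] , (apart ∷ []) ∷ [] ∷ [])
      , (k≢k′ ∷ []) ∷ [] ∷ [] , ∈F p ∷ ∈F p′ ∷ [])
      (k∈J ∷ k′∈J ∷ [])
      (avoids p ∷ avoids p′ ∷ [])
      (s≤s (s≤s z≤n))
    where
    apart : ¬ Intersects (edge p) (edge p′)
    apart = Ends-avoids (ends p)
      (∉-Ends (ends p′) s≢s′ (covered≢uncovered e∈ (end∈ p) (uncovered p′)))
      (∉-Ends (ends p′) (≢-sym (covered≢uncovered e∈ (end∈ p′) (uncovered p))) x≢x′)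
    avoids : ∀ {k s x} (p : Pendant k e s x) {h} → h ∈ Rₑ → h ∉ e ∷ [] → ¬ Intersects (edge p) h
    avoids p h∈ h∉ = pendant-avoids e∈ p h∈ (λ h≡e → h∉ (here h≡e))

  ¬pendant-bridge-pendant : ∀ {k₁ k₂ k₃ e f s x t d c z} → e ∈ Rₑ → f ∈ Rₑ → e ≢ f →
    J k₁ → J k₂ → J k₃ → Pendant k₁ e s x → Bridge k₂ e f t d → Pendant k₃ f c z →
    s ≢ t → c ≢ d → k₁ ≢ k₂ → k₁ ≢ k₃ → k₂ ≢ k₃ → x ≢ z → ⊥
  ¬pendant-bridge-pendant {k₁} {k₂} {k₃} {e} {f}
    e∈ f∈ e≢f k₁∈J k₂∈J k₃∈J p β p′ s≢t c≢d k₁≢k₂ k₁≢k₃ k₂≢k₃ x≢z =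
    augment (e ∷ f ∷ []) ((edge p , k₁) ∷ (edge β , k₂) ∷ (edge p′ , k₃) ∷ [])
      ( ( F-valid (∈F p) ∷ F-valid (∈F β) ∷ F-valid (∈F p′) ∷ []
        , (p-β ∷ p-p′ ∷ []) ∷ (β-p′ ∷ []) ∷ [] ∷ [])
      , (k₁≢k₂ ∷ k₁≢k₃ ∷ []) ∷ (k₂≢k₃ ∷ []) ∷ [] ∷ []
      , ∈F p ∷ ∈F β ∷ ∈F p′ ∷ [])
      (k₁∈J ∷ k₂∈J ∷ k₃∈J ∷ [])
      ( (λ h∈ h∉ → pendant-avoids e∈ p h∈ (≢e h∉))
      ∷ (λ h∈ h∉ → bridge-avoids e∈ f∈ β h∈ (≢e h∉) (≢f h∉))
      ∷ (λ h∈ h∉ → pendant-avoids f∈ p′ h∈ (≢f h∉))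
      ∷ [])
      (s≤s (s≤s (s≤s z≤n)))
    where
    ≢e : ∀ {h} → h ∉ e ∷ f ∷ [] → h ≢ e
    ≢e h∉ h≡e = h∉ (here h≡e)
    ≢f : ∀ {h} → h ∉ e ∷ f ∷ [] → h ≢ f
    ≢f h∉ h≡f = h∉ (there (here h≡f))
    p-β : ¬ Intersects (edge p) (edge β)
    p-β = Ends-avoids (ends p)
      (∉-Ends (ends β) s≢t (separate e∈ f∈ e≢f (end∈ p) (d∈ β)))
      (∉-Ends (ends β) (≢-sym (covered≢uncovered e∈ (t∈ β) (uncovered p)))
                       (≢-sym (covered≢uncovered f∈ (d∈ β) (uncovered p))))
    p-p′ : ¬ Intersects (edge p) (edge p′)
    p-p′ = Ends-avoids (ends p)
      (∉-Ends (ends p′) (separate e∈ f∈ e≢f (end∈ p) (end∈ p′))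
                        (covered≢uncovered e∈ (end∈ p) (uncovered p′)))
      (∉-Ends (ends p′) (≢-sym (covered≢uncovered f∈ (end∈ p′) (uncovered p))) x≢z)
    β-p′ : ¬ Intersects (edge β) (edge p′)
    β-p′ = Ends-avoids (ends β)
      (∉-Ends (ends p′) (separate e∈ f∈ e≢f (t∈ β) (end∈ p′))
                        (covered≢uncovered e∈ (t∈ β) (uncovered p′)))
      (∉-Ends (ends p′) (≢-sym c≢d) (covered≢uncovered f∈ (d∈ β) (uncovered p′)))

  record PendantAt (e : Edge) : Set where
    field
      colour : Fin n
      colour∈J : J colour
      end outer : ℕ
      pendant : Pendant colour e end outer

  open PendantAt

  Rainbow : ∀ {e} → List (PendantAt e) → Set
  Rainbow = AllPairs (λ a b → colour a ≢ colour b)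

  -- Forbidding a colour or an outer vertex rules out at most one pendant of a rainbow list at a
  -- common end, since two pendants with the same ends are the same edge.
  choose : ∀ {e s} (cs : List (PendantAt e)) → All (λ c → end c ≡ s) cs → Rainbow cs →
           (ms : List (Fin n)) (vs : List ℕ) → length ms + length vs < length cs →
           ∃[ c ] c ∈ cs × All (colour c ≢_) ms × All (outer c ≢_) vs
  choose {e} cs at-s rainbow ms vs fewer
    with avoid Hits Hits? (map inj₁ ms ++ map inj₂ vs) unshared fewer′
    where
    Hits : PendantAt e → Fin n ⊎ ℕ → Set
    Hits c (inj₁ m) = colour c ≡ m
    Hits c (inj₂ v) = outer c ≡ v
    Hits? : ∀ c k → Dec (Hits c k)
    Hits? c (inj₁ m) = colour c Fin.≟ m
    Hits? c (inj₂ v) = outer c ≟ v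
    unshared : AllPairs (λ a b → ∀ k → ¬ (Hits a k × Hits b k)) cs
    unshared = All-AllPairs⇒AllPairs at-s (AllPairs.map (λ {a} {b} a≢b a-s b-s → λ
      { (inj₁ m) (a≡m , b≡m) → a≢b (trans a≡m (sym b≡m))
      ; (inj₂ v) (a≡v , b≡v) → a≢b (same-ends⇒same-colour (pendant a) (pendant b)
                                      (trans a-s (sym b-s)) (trans a≡v (sym b≡v))) }) rainbow)
    fewer′ : length (map inj₁ ms ++ map inj₂ vs) < length cs
    fewer′ = subst (_< length cs)
      (sym (trans (length-++ (map inj₁ ms)) (cong₂ _+_ (length-map inj₁ ms) (length-map inj₂ vs))))
      fewer
  ... | c , c∈ , misses =
    c , c∈ , All-map⁻ (All-++⁻ˡ _ misses) , All-map⁻ (All-++⁻ʳ (map inj₁ ms) misses)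

  crowded-end : ∀ {e s} → e ∈ Rₑ → (cs : List (PendantAt e)) → All (λ c → end c ≡ s) cs → Rainbow cs →
                2 < length cs → (p : PendantAt e) → end p ≢ s → ⊥
  crowded-end e∈ cs at-s rainbow 2<cs p p≢s
    with choose cs at-s rainbow (colour p ∷ []) (outer p ∷ []) 2<cs
  ... | c , c∈ , (c≢p ∷ []) , (c-off ∷ []) =
    ¬two-pendants e∈ (colour∈J c) (colour∈J p) (pendant c) (pendant p)
      (λ c≡p → p≢s (trans (sym c≡p) (All.lookup at-s c∈))) c≢p c-off

  -- Were some pendant at the other end t, one of the two ends would carry three of the five and be
  -- crowded.
  one-sided : ∀ {e} → e ∈ Rₑ → (cs : List (PendantAt e)) → Rainbow cs → 4 < length cs →
              (p : PendantAt e) → All (λ c → end c ≡ end p) cs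
  one-sided {e} e∈ cs rainbow 4<cs p with All.all? (λ c → end c ≟ end p) cs
  ... | yes all-at-s = all-at-s
  ... | no ¬all-at-s = ⊥-elim (crowded (satisfied (¬All⇒Any¬ at-s? cs ¬all-at-s)))
    where
    at-s? : (c : PendantAt e) → Dec (end c ≡ end p)
    at-s? c = end c ≟ end p
    at-s at-t : List (PendantAt e)
    at-s = filter at-s? cs
    at-t = filter (∁? at-s?) cs
    other = other-end (R-valid e∈) (end∈ (pendant p))
    t = proj₁ other
    s≢t = proj₁ (proj₂ other)
    at-t-ends : All (λ c → end c ≡ t) at-t
    at-t-ends = All.tabulate λ {c} c∈ →
      forced-t (proj₂ (proj₂ (proj₂ (proj₂ other))) (end c) (end∈ (pendant c)))
               (proj₂ (∈-filter⁻ (∁? at-s?) {xs = cs} c∈))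
      where
      forced-t : ∀ {v} → v ≡ end p ⊎ v ≡ t → v ≢ end p → v ≡ t
      forced-t (inj₁ v≡s) v≢s = contradiction v≡s v≢s
      forced-t (inj₂ v≡t) _   = v≡t
    crowded : ∃[ c ] end c ≢ end p → ⊥
    crowded (c , c≢s) with 2 <? length at-s
    ... | yes 2<at-s =
      crowded-end e∈ at-s (all-filter at-s? cs) (AllPairs.filter⁺ at-s? rainbow) 2<at-s c c≢s
    ... | no  2≮at-s =
      crowded-end e∈ at-t at-t-ends (AllPairs.filter⁺ (∁? at-s?) rainbow) 2<at-t p s≢t
      where
      2<at-t : 2 < length at-t
      2<at-t = +-cancelˡ-< 2 2 (length at-t) (<-≤-trans
        (subst (4 <_) (sym (length-filter+filter-∁ at-s? cs)) 4<cs)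
        (+-monoˡ-≤ (length at-t) (≮⇒≥ 2≮at-s)))

  record Wasteful (k : Fin n) (e f : Edge) : Set where
    field
      k∈J : J k
      e∈R : e ∈ Rₑ
      f∈R : f ∈ Rₑ
      e≢f : e ≢ f
      s x t d c z : ℕ
      at-e : Pendant k e s x
      across : Bridge k e f t d
      at-f : Pendant k f c z
      s≢t : s ≢ t
      c≢d : c ≢ d

  wasteful : ∀ {k e f} → J k → e ∈ Rₑ → f ∈ Rₑ → HalfWasteful F R k e f → Wasteful k e f
  wasteful k∈J e∈ f∈ (e≢f , _ , _ , _ , gₑ∈ , g_f∈ , g∈ , only-e , only-f , meets-e , meets-f)
    with only-meets⇒pendant k∈J e∈ gₑ∈ only-e | meets-both⇒bridge e∈ f∈ e≢f g∈ meets-e meets-f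
       | only-meets⇒pendant k∈J f∈ g_f∈ only-f
  ... | s , x , pₑ | t , d , β | c , z , p_f = record
    { k∈J = k∈J ; e∈R = e∈ ; f∈R = f∈ ; e≢f = e≢f ; s = s ; x = x ; t = t ; d = d ; c = c ; z = z
    ; at-e = pₑ ; across = β ; at-f = p_f
    ; s≢t = λ { refl → pendant-bridge-apart e∈ f∈ e≢f pₑ β (s , proj₁ (ends pₑ) , proj₁ (ends β)) }
    ; c≢d = λ { refl →
        pendant-bridge-apart e∈ f∈ e≢f p_f β (c , proj₁ (ends p_f) , proj₁ (proj₂ (ends β))) }
    }

  Wasteful-sym : ∀ {k e f} → Wasteful k e f → Wasteful k f e
  Wasteful-sym W = record
    { k∈J = k∈J ; e∈R = f∈R ; f∈R = e∈R ; e≢f = ≢-sym e≢f ; s = c ; x = z ; t = d ; d = t ; c = s ; z = x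
    ; at-e = at-f ; at-f = at-e ; s≢t = c≢d ; c≢d = s≢t
    ; across = record { edge = edge across ; ∈F = ∈F across ; ends = Ends-swap (ends across)
                      ; t∈ = d∈ across ; d∈ = t∈ across } }
    where open Wasteful W

  pendant-at-e : ∀ {k e f} → Wasteful k e f → PendantAt e
  pendant-at-e W = record { colour = _ ; colour∈J = k∈J ; end = s ; outer = x ; pendant = at-e }
    where open Wasteful W

  -- The bridge of W′ cannot end at the covered end of W's pendant at f, so it meets, hence equals,
  -- the bridge of W; its other end then lies on e.
  wasteful-partner-unique : ∀ {k e e′ f} → Wasteful k e f → Wasteful k e′ f → e ≡ e′
  wasteful-partner-unique {e = e} W W′ = R-meet⇒≡ W.e∈R W′.e∈R (W′.t , t′∈e , t∈ W′.across)
    where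
    module W = Wasteful W
    module W′ = Wasteful W′
    f-ends = distinct-Ends (end∈ W.at-f) (d∈ W.across) W.c≢d
    d′∈β′ = proj₁ (proj₂ (ends W′.across))
    d′≡d : W′.d ≡ W.d
    d′≡d with proj₂ (proj₂ f-ends) W′.d (d∈ W′.across)
    ... | inj₂ d′≡d = d′≡d
    ... | inj₁ d′≡c = ⊥-elim (pendant-bridge-apart W′.e∈R W′.f∈R W′.e≢f W.at-f W′.across
                        (W.c , proj₁ (ends W.at-f) , subst (_∈ᵥ edge W′.across) d′≡c d′∈β′))
    same-bridge : edge W.across ≡ edge W′.across
    same-bridge = F-meet⇒≡ (∈F W.across) (∈F W′.across)
      (W.d , proj₁ (proj₂ (ends W.across)) , subst (_∈ᵥ edge W′.across) d′≡d d′∈β′)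
    t′∈e : W′.t ∈ᵥ e
    t′∈e with proj₂ (proj₂ (ends W.across)) W′.t
                (subst (W′.t ∈ᵥ_) (sym same-bridge) (proj₁ (ends W′.across)))
    ... | inj₁ t′≡t = subst (_∈ᵥ e) (sym t′≡t) (t∈ W.across)
    ... | inj₂ t′≡d = ⊥-elim (separate W′.e∈R W′.f∈R W′.e≢f (t∈ W′.across) (d∈ W.across) t′≡d)

  -- A pendant at f of a colour other than j must sit at the bridge's end d with W's outer vertex z:
  -- at the end c it would complete a pendant–bridge–pendant exchange with one of the pendants at e,
  -- and with another outer vertex it would be exchanged together with W's pendant at f.
  heavy-partner : ∀ {j e f} → (cs : List (PendantAt e)) → Rainbow cs → 4 < length cs → Wasteful j e f →
                  (ps : List (PendantAt f)) → Rainbow ps → length ps ≤ 2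
  heavy-partner {j} cs rainbow 4<cs W ps ps-rainbow =
    all-hit⇒length≤ Kind Kind? (false ∷ true ∷ []) unshared (All.tabulate λ {p} _ → classify p)
    where
    open Wasteful W
    Kind : PendantAt _ → Bool → Set
    Kind p false = colour p ≡ j
    Kind p true  = end p ≡ d × outer p ≡ z
    Kind? : ∀ p b → Dec (Kind p b)
    Kind? p false = colour p Fin.≟ j
    Kind? p true  = (end p ≟ d) ×-dec (outer p ≟ z)
    unshared : AllPairs (λ a b → ∀ k → ¬ (Kind a k × Kind b k)) ps
    unshared = AllPairs.map (λ {a} {b} a≢b → λ
      { false (a≡j , b≡j) → a≢b (trans a≡j (sym b≡j))
      ; true ((a-d , a-z) , (b-d , b-z)) →
          a≢b (same-ends⇒same-colour (pendant a) (pendant b) (trans a-d (sym b-d)) (trans a-z (sym b-z))) })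
      ps-rainbow
    f-ends = distinct-Ends (end∈ at-f) (d∈ across) c≢d
    at-s = one-sided e∈R cs rainbow 4<cs (pendant-at-e W)
    classify : (p : PendantAt _) → Any (Kind p) (false ∷ true ∷ [])
    classify p with colour p Fin.≟ j
    ... | yes p≡j = here p≡j
    ... | no  p≢j with proj₂ (proj₂ f-ends) (end p) (end∈ (pendant p))
    ...   | inj₂ at-d with outer p ≟ z
    ...     | yes at-z  = there (here (at-d , at-z))
    ...     | no  off-z = ⊥-elim (¬two-pendants f∈R (colour∈J p) k∈J (pendant p) at-f
                            (λ p≡c → c≢d (trans (sym p≡c) at-d)) p≢j off-z)
    classify p | no p≢j | inj₁ at-c
      with choose cs at-s rainbow (j ∷ colour p ∷ []) (outer p ∷ []) (<⇒≤ 4<cs)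
    ... | c′ , c′∈ , (c′≢j ∷ c′≢p ∷ []) , (c′-off ∷ []) =
      ⊥-elim (¬pendant-bridge-pendant e∈R f∈R e≢f (colour∈J c′) k∈J (colour∈J p)
        (pendant c′) across (pendant p)
        (λ c′≡t → s≢t (trans (sym (All.lookup at-s c′∈)) c′≡t))
        (λ p≡d → c≢d (trans (sym at-c) p≡d))
        c′≢j c′≢p (≢-sym p≢j) c′-off)

  q : ℕ
  q = length R

  R-edge : Fin q → Edge
  R-edge i = proj₁ (lookup R i)

  R-edge∈ : ∀ i → R-edge i ∈ Rₑ
  R-edge∈ i = ∈-map⁺ proj₁ (∈-lookup i)

  R-edge-injective : ∀ i i′ → R-edge i ≡ R-edge i′ → i ≡ i′
  R-edge-injective = lookup-injective proj₁ (AllPairs.map disjoint⇒≢ R-apart)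

  R-index : ∀ {f} → f ∈ Rₑ → ∃[ i ] R-edge i ≡ f
  R-index f∈ with ∈-map⁻ proj₁ f∈
  ... | _ , p∈R , refl = Any.index p∈R , cong proj₁ (sym (lookup-index p∈R))

  Incidence : Set
  Incidence = Σ (Fin q × Fin n) λ p → InHW F R (R-edge (proj₁ p)) (proj₂ p)

  index-of : Incidence → Fin q
  index-of x = proj₁ (proj₁ x)

  colour-of : Incidence → Fin n
  colour-of x = proj₂ (proj₁ x)

  partner : Incidence → Edge
  partner (_ , _ , f , _) = f

  waste : (x : Incidence) → Wasteful (colour-of x) (R-edge (index-of x)) (partner x)
  waste ((i , _) , j∈J , _ , f∈ , half-wasteful) = wasteful j∈J (R-edge∈ i) f∈ half-wasteful

  same-index⇒colours-differ : ∀ {a b} → index-of a ≡ index-of b → proj₁ a ≢ proj₁ b →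
                              colour-of a ≢ colour-of b
  same-index⇒colours-differ ia≡ib a≢b ca≡cb = a≢b (×-≡,≡→≡ (ia≡ib , ca≡cb))

  module _ (g : Incidence → Fin q) (w : ∀ x → Σ Edge (Wasteful (colour-of x) (R-edge (g x)))) where

    pendants : ∀ {i ys} → All (λ y → g y ≡ i) ys → List (PendantAt (R-edge i))
    pendants [] = []
    pendants {ys = y ∷ _} (refl ∷ at-i) = pendant-at-e (proj₂ (w y)) ∷ pendants at-i

    length-pendants : ∀ {i ys} (at-i : All (λ y → g y ≡ i) ys) → length (pendants at-i) ≡ length ys
    length-pendants [] = refl
    length-pendants (refl ∷ at-i) = cong suc (length-pendants at-i)

    rainbow-pendants : ∀ {i ys} (at-i : All (λ y → g y ≡ i) ys) →
                       AllPairs (λ a b → colour-of a ≢ colour-of b) ys → Rainbow (pendants at-i)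
    rainbow-pendants [] [] = []
    rainbow-pendants {ys = y ∷ _} (refl ∷ at-i) (y-differs ∷ rest) =
      differs at-i y-differs ∷ rainbow-pendants at-i rest
      where
      differs : ∀ {i zs} (at-i′ : All (λ z → g z ≡ i) zs) → All (λ b → colour-of y ≢ colour-of b) zs →
                All (λ p → colour-of y ≢ colour p) (pendants at-i′)
      differs [] [] = []
      differs (refl ∷ at-i′) (d ∷ ds) = d ∷ differs at-i′ ds

  module Charging (xs : List Incidence) (distinct : AllPairs (λ a b → proj₁ a ≢ proj₁ b) xs) where

    load : Fin q → ℕ
    load i = length (filter (λ x → index-of x Fin.≟ i) xs)

    Heavy Light : Incidence → Set
    Heavy x = 4 < load (index-of x)
    Light x = ¬ Heavy x

    Heavy? : ∀ x → Dec (Heavy x)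
    Heavy? x = 4 <? load (index-of x)

    partner-index : Incidence → Fin q
    partner-index x = proj₁ (R-index (Wasteful.f∈R (waste x)))

    target : Incidence → Fin q
    target x with Heavy? x
    ... | yes _ = partner-index x
    ... | no  _ = index-of x

    light-target : ∀ x → Light x → target x ≡ index-of x
    light-target x light with Heavy? x
    ... | yes heavy = contradiction heavy light
    ... | no  _     = refl

    heavy-target : ∀ x → Heavy x → R-edge (target x) ≡ partner x
    heavy-target x heavy with Heavy? x
    ... | yes _     = proj₂ (R-index (Wasteful.f∈R (waste x)))
    ... | no  light = contradiction heavy light

    target-waste : ∀ x → Σ Edge (Wasteful (colour-of x) (R-edge (target x)))
    target-waste x with Heavy? x
    ... | yes _ = _ , subst (λ e → Wasteful (colour-of x) e (R-edge (index-of x)))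
                            (sym (proj₂ (R-index (Wasteful.f∈R (waste x)))))
                            (Wasteful-sym (waste x))
    ... | no  _ = _ , waste x

    own-waste : ∀ x → Σ Edge (Wasteful (colour-of x) (R-edge (index-of x)))
    own-waste x = partner x , waste x

    heavy⇒colours-differ : ∀ {a b} → Heavy a → Heavy b → target a ≡ target b → proj₁ a ≢ proj₁ b →
                           colour-of a ≢ colour-of b
    heavy⇒colours-differ {a} {b} a-heavy b-heavy same-target a≢b ca≡cb =
      a≢b (×-≡,≡→≡ (R-edge-injective _ _ same-edge , ca≡cb))
      where
      same-partner : partner b ≡ partner a
      same-partner =
        trans (sym (heavy-target b b-heavy)) (trans (cong R-edge (sym same-target)) (heavy-target a a-heavy))
      same-edge : R-edge (index-of a) ≡ R-edge (index-of b)
      same-edge = wasteful-partner-unique (waste a)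
        (subst₂ (λ k f → Wasteful k (R-edge (index-of b)) f) (sym ca≡cb) same-partner (waste b))

    few-colours : ∀ {z} y → Heavy y → target y ≡ z →
                  (ys : List Incidence) (at-z : All (λ y → target y ≡ z) ys) →
                  AllPairs (λ a b → colour-of a ≢ colour-of b) ys → length ys ≤ 2
    few-colours {z} y y-heavy y-z ys at-z rainbow = begin
      length ys                            ≡⟨ sym (length-pendants target target-waste at-z) ⟩
      length (pendants target target-waste at-z)
        ≤⟨ heavy-partner cs cs-rainbow 4<cs W _ (rainbow-pendants target target-waste at-z rainbow) ⟩
      2                                    ∎
      where
      open ≤-Reasoning
      on-y? = λ x → index-of x Fin.≟ index-of y
      on-y = all-filter on-y? xs
      cs = pendants index-of own-waste on-y
      cs-rainbow : Rainbow cs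
      cs-rainbow = rainbow-pendants index-of own-waste on-y (All-AllPairs⇒AllPairs on-y
        (AllPairs.map (λ {a} {b} a≢b a-y b-y → same-index⇒colours-differ {a} {b} (trans a-y (sym b-y)) a≢b)
          (AllPairs.filter⁺ on-y? distinct)))
      4<cs : 4 < length cs
      4<cs = subst (4 <_) (sym (length-pendants index-of own-waste on-y)) y-heavy
      W : Wasteful (colour-of y) (R-edge (index-of y)) (R-edge z)
      W = subst (Wasteful _ _) (trans (sym (heavy-target y y-heavy)) (cong R-edge y-z)) (waste y)

    some-heavy-bound : ∀ {z} (ys : List Incidence) → All (λ y → target y ≡ z) ys →
                       AllPairs (λ a b → proj₁ a ≢ proj₁ b) ys → Any Heavy ys → length ys ≤ 4
    some-heavy-bound ys at-z ys-distinct some-heavy = begin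
      length ys                         ≡⟨ sym (length-filter+filter-∁ Heavy? ys) ⟩
      length heavies + length lights    ≤⟨ +-mono-≤
                                             (few heavies (All-filter⁺ Heavy? at-z) heavies-rainbow)
                                             (few lights (All-filter⁺ (∁? Heavy?) at-z) lights-rainbow) ⟩
      4                                 ∎
      where
      open ≤-Reasoning
      found = find some-heavy
      few = few-colours (proj₁ found) (proj₂ (proj₂ found)) (All.lookup at-z (proj₁ (proj₂ found)))
      heavies lights : List Incidence
      heavies = filter Heavy? ys
      lights = filter (∁? Heavy?) ys
      heavies-rainbow : AllPairs (λ a b → colour-of a ≢ colour-of b) heavies
      heavies-rainbow = All-AllPairs⇒AllPairs (All.zip (all-filter Heavy? ys , All-filter⁺ Heavy? at-z))
        (AllPairs.map (λ a≢b (a-heavy , a-z) (b-heavy , b-z) →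
                         heavy⇒colours-differ a-heavy b-heavy (trans a-z (sym b-z)) a≢b)
          (AllPairs.filter⁺ Heavy? ys-distinct))
      lights-rainbow : AllPairs (λ a b → colour-of a ≢ colour-of b) lights
      lights-rainbow = All-AllPairs⇒AllPairs
        (All.zip (all-filter (∁? Heavy?) ys , All-filter⁺ (∁? Heavy?) at-z))
        (AllPairs.map (λ {a} {b} a≢b (a-light , a-z) (b-light , b-z) → same-index⇒colours-differ {a} {b}
            (trans (sym (light-target a a-light)) (trans a-z (trans (sym b-z) (light-target b b-light)))) a≢b)
          (AllPairs.filter⁺ (∁? Heavy?) ys-distinct))

    all-light-bound : ∀ {z} (ys : List Incidence) → All (λ y → target y ≡ z) ys → All Light ys →
                      ys ⊆ xs → length ys ≤ 4
    all-light-bound [] _ _ _ = z≤n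
    all-light-bound {z} ys@(_ ∷ _) at-z all-light ys⊆xs = begin
      length ys                ≡⟨ cong length (sym (filter-all on-z? at-index)) ⟩
      length (filter on-z? ys) ≤⟨ Sublist.length-mono-≤
                                    (Sublist.filter⁺ on-z? on-z? (λ { refl p → p }) ys⊆xs) ⟩
      load z                   ≤⟨ ≮⇒≥ (subst (λ i → ¬ 4 < load i)
                                            (All.head at-index) (All.head all-light)) ⟩
      4                        ∎
      where
      open ≤-Reasoning
      on-z? = λ x → index-of x Fin.≟ z
      at-index : All (λ y → index-of y ≡ z) ys
      at-index = All.zipWith (λ {y} (y-light , y-z) → trans (sym (light-target y y-light)) y-z)
                             (all-light , at-z)

    fibre-bound : ∀ z → length (fibre target z xs) ≤ 4
    fibre-bound z with any? Heavy? (fibre target z xs)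
    ... | yes some-heavy =
      some-heavy-bound _ (all-filter on-z? xs) (AllPairs.filter⁺ on-z? distinct) some-heavy
      where on-z? = λ x → target x Fin.≟ z
    ... | no  no-heavy   =
      all-light-bound _ (all-filter on-z? xs) (¬Any⇒All¬ _ no-heavy) (Sublist.filter-⊆ on-z? xs)
      where on-z? = λ x → target x Fin.≟ z

    length≤4*q : length xs ≤ 4 * q
    length≤4*q = subst (length xs ≤_) (*-comm q 4) (length≤*-fibres target 4 xs fibre-bound)

lemma2p9 : (n : ℕ) (F : Fin n → List Edge)
    → ((i : Fin n) → IsMatching (F i))
    → ((i : Fin n) → length (F i) ≡ n)
    → ((i j : Fin n) → i ≢ j → (e : Edge) → e ∈ F i → e ∉ F j)
    → (R : List (Edge × Fin n)) → IsMaximumRainbow F R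
    → (P : List (Fin (length R) × Fin n)) → Unique P
    → All (λ p → InHW F R (proj₁ (lookup R (proj₁ p))) (proj₂ p)) P
    → length P ≤ 4 * length R
lemma2p9 n F F-matching _ F-disjoint R R-maximum P P-unique P-in-HW =
  subst (_≤ 4 * length R) length-incidences (Charging.length≤4*q incidences distinct)
  where
  open MaximumRainbow n F F-matching F-disjoint R R-maximum
  incidences = All.toList P-in-HW
  incidences-over-P : map proj₁ incidences ≡ P
  incidences-over-P = map-proj₁-toList P-in-HW
  length-incidences : length incidences ≡ length P
  length-incidences = trans (sym (length-map proj₁ incidences)) (cong length incidences-over-P)
  distinct : AllPairs (λ a b → proj₁ a ≢ proj₁ b) incidences
  distinct = AllPairs.map⁻ (subst Unique (sym incidences-over-P) P-unique)
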